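{- Let $I=C_k$ or $I=\mathbb Z$, let $(\mathfrak M_i)_{i\in I}$, $\mathfrak M_i=\langle M_i,\mathcal L_i,\mathrm I_i\rangle$, be connected partial linear spaces and $\phi_i=(\phi'_i,\phi''_i)$ correlations of $\mathfrak M_i$ onto $\mathfrak M_{i+1}$, and let $\mathfrak M_0=\langle S_0,L_0,\mathrm I_0\rangle$ be the member of index $0$. (i) If $I=\mathbb Z$, then $\circledast_{i\in I}(\mathfrak M_i,\phi_i)\cong \mathfrak M_0\circledast_{\circ}\mathbb Z$. (ii) If $I=C_k$ with $k$ even, $k>2$, and $\phi_{k-1}\circ\dots\circ\phi_1\circ\phi_0=\mathrm{id}$, then $\circledast_{i\in I}(\mathfrak M_i,\phi_i)\cong \mathfrak M_0\circledast_{\circ}C_k$.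
   Context: PLS: incidence structure $\langle S,\mathcal L,\mathrm I\rangle$, $S\cap\mathcal L=\emptyset$, every line on at least two points, every point on at least two lines, two distinct points on at most one common line; connected means connected collinearity graph. A correlation of $\langle S_1,\mathcal L_1,\mathrm I_1\rangle$ onto $\langle S_2,\mathcal L_2,\mathrm I_2\rangle$ is a pair $(\phi',\phi'')$ of bijections $S_1\to\mathcal L_2$, $\mathcal L_1\to S_2$ with $a\,\mathrm I_1\,l\iff\phi''(l)\,\mathrm I_2\,\phi'(a)$; correlations and collineations are composed componentwise in the natural way ($(\psi\phi)'=\psi''\phi'$, $(\psi\phi)''=\psi'\phi''$), so $\phi_{k-1}\cdots\phi_0$ is a collineation of $\mathfrak M_0$ when $k$ is even. Glued structure $\circledast_{i\in I}(\mathfrak M_i,\phi_i)$: points $\bigcup_i\{i\}\times M_i$, lines $\bigcup_i\{i\}\times\mathcal L_i$ (written $[i,m]$), $(i,a)\,\mathrm I\,[j,m]$ iff either $i=j$ and $a\,\mathrm I_i\,m$, or $i=j+1$ and $a=\phi''_j(m)$. Dual multiplying: for a PLS $\mathfrak M_0=\langle S_0,L_0,\mathrm I_0\rangle$ and a cyclic group $G$ which is either $\mathbb Z$ or $C_k$ with $k$ even, $k>2$ (so parity of elements is well defined), $\mathfrak M_0\circledast_\circ G$ has point set $\bigcup_{i\in G}M_i$ and line set $\bigcup_{i\in G}\mathcal L_i$, where $M_i=\{i\}\times S_0$, $\mathcal L_i=\{i\}\times L_0$ for even $i$ and $M_i=\{i\}\times L_0$, $\mathcal L_i=\{i\}\times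 S_0$ for odd $i$; points are written $(i,a)$, lines $[j,b]$, and $(i,a)\,\mathrm I\,[j,b]$ iff either $i=j$ and ($a\,\mathrm I_0\,b$ or $b\,\mathrm I_0\,a$), or $i=j+1$ and $a=b$. -}

module Defs where

open import Data.Bool using (Bool; true; false; not)
open import Data.Empty using (⊥)
open import Data.Nat using (ℕ; zero; suc; NonZero)
open import Data.Nat.DivMod using (_mod_)
open import Data.Integer using (ℤ; +_; -[1+_])
import Data.Integer as ℤ
open import Data.Fin using (Fin; toℕ)
open import Data.Product using (Σ; _×_; _,_; ∃)
open import Data.Sum using (_⊎_)
open import Function.Bundles using (_↔_; _⇔_; Inverse; Equivalence)
open import Relation.Binary.PropositionalEquality using (_≡_; _≢_)
open import Relation.Binary.Construct.Closure.ReflexiveTransitive using (Star)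

record IncStr : Set₁ where
  field
    Point : Set
    Line  : Set
    _I_   : Point → Line → Set

open IncStr public

Collinear : (M : IncStr) → Point M → Point M → Set
Collinear M a b = Σ (Line M) λ l → (_I_ M a l) × (_I_ M b l)

record IsPLS (M : IncStr) : Set where
  field
    line-two-points : ∀ (l : Line M) →
      Σ (Point M) λ a → Σ (Point M) λ b → a ≢ b × _I_ M a l × _I_ M b l
    point-two-lines : ∀ (a : Point M) →
      Σ (Line M) λ l → Σ (Line M) λ m → l ≢ m × _I_ M a l × _I_ M a m
    unique-line : ∀ (a b : Point M) (l m : Line M) → a ≢ b →
      _I_ M a l → _I_ M b l → _I_ M a m → _I_ M b m → l ≡ m

Connected : IncStr → Set
Connected M = ∀ (a b : Point M) → Star (Collinear M) a b

record ConnPLS : Set₁ where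
  field
    str       : IncStr
    isPLS     : IsPLS str
    connected : Connected str

record Correlation (M N : IncStr) : Set where
  field
    φ′  : Point M ↔ Line N
    φ″  : Line M ↔ Point N
    inc : ∀ (a : Point M) (l : Line M) →
      _I_ M a l ⇔ _I_ N (Inverse.to φ″ l) (Inverse.to φ′ a)

record Iso (M N : IncStr) : Set where
  field
    pt  : Point M ↔ Point N
    ln  : Line M ↔ Line N
    inc : ∀ (a : Point M) (l : Line M) →
      _I_ M a l ⇔ _I_ N (Inverse.to pt a) (Inverse.to ln l)

_≅ᴵ_ : IncStr → IncStr → Set
M ≅ᴵ N = Iso M N

module Glue (G : Set) (sc : G → G) (M : G → IncStr)
            (φ : (i : G) → Correlation (M i) (M (sc i))) where

  GPoint : Set
  GPoint = Σ G λ i → Point (M i)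

  GLine : Set
  GLine = Σ G λ i → Line (M i)

  data GInc : GPoint → GLine → Set where
    same : ∀ {i a m} → _I_ (M i) a m → GInc (i , a) (i , m)
    next : ∀ {j} (m : Line (M j)) →
      GInc (sc j , Inverse.to (Correlation.φ″ (φ j)) m) (j , m)

  glued : IncStr
  glued = record { Point = GPoint ; Line = GLine ; _I_ = GInc }

  Elt : G → Bool → Set
  Elt i true  = Point (M i)
  Elt i false = Line (M i)

  step : (j : G) (b : Bool) → Elt j b → Elt (sc j) (not b)
  step j true  x = Inverse.to (Correlation.φ′ (φ j)) x
  step j false x = Inverse.to (Correlation.φ″ (φ j)) x

  scⁿ : ℕ → G → G
  scⁿ zero    j = j
  scⁿ (suc n) j = scⁿ n (sc j)

  flipⁿ : ℕ → Bool → Bool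
  flipⁿ zero    b = b
  flipⁿ (suc n) b = flipⁿ n (not b)

  -- φ_{j+n-1} ∘ … ∘ φ_j applied to an element
  iter : (n : ℕ) (j : G) (b : Bool) → Elt j b → Elt (scⁿ n j) (flipⁿ n b)
  iter zero    j b x = x
  iter (suc n) j b x = iter n (sc j) (not b) (step j b x)

glue : (G : Set) (sc : G → G) (M : G → IncStr)
       (φ : (i : G) → Correlation (M i) (M (sc i))) → IncStr
glue G sc M φ = Glue.glued G sc M φ

-- Dual multiplying over a "cyclic" index set with parity
-- par i = true  : i even, M_i = S0 (points), L_i = L0
-- par i = false : i odd,  M_i = L0 (points), L_i = S0

module DualMult (M0 : IncStr) (G : Set) (sc : G → G) (par : G → Bool) where

  Pt : Bool → Set
  Pt true  = Point M0
  Pt false = Line M0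

  Ln : Bool → Set
  Ln true  = Line M0
  Ln false = Point M0

  IncE : (p : Bool) → Pt p → Ln p → Set
  IncE true  a b = _I_ M0 a b
  IncE false a b = _I_ M0 b a

  -- a = b, for a point of index sc j and a line of index j
  SameE : (q p : Bool) → Pt q → Ln p → Set
  SameE true  false a b = a ≡ b
  SameE false true  a b = a ≡ b
  SameE true  true  a b = ⊥
  SameE false false a b = ⊥

  DPoint : Set
  DPoint = Σ G λ i → Pt (par i)

  DLine : Set
  DLine = Σ G λ j → Ln (par j)

  data DInc : DPoint → DLine → Set where
    same : ∀ {i a b} → IncE (par i) a b → DInc (i , a) (i , b)
    next : ∀ {j a b} → SameE (par (sc j)) (par j) a b → DInc (sc j , a) (j , b)

  dual : IncStr
  dual = record { Point = DPoint ; Line = DLine ; _I_ = DInc }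

dualMult : (M0 : IncStr) (G : Set) (sc : G → G) (par : G → Bool) → IncStr
dualMult M0 G sc par = DualMult.dual M0 G sc par

evenℕ : ℕ → Bool
evenℕ zero    = true
evenℕ (suc n) = not (evenℕ n)

sucℤ : ℤ → ℤ
sucℤ i = ℤ.suc i

-- parity on ℤ (true = even);  -[1+ n ] = -(n+1)
evenℤ : ℤ → Bool
evenℤ (+ n)    = evenℕ n
evenℤ -[1+ n ] = not (evenℕ n)

-- successor in C_k = ℤ/kℤ, represented by Fin k
sucC : (k : ℕ) .{{_ : NonZero k}} → Fin k → Fin k
sucC k i = suc (toℕ i) mod k

evenC : (k : ℕ) → Fin k → Bool
evenC k i = evenℕ (toℕ i)

zeroC : (k : ℕ) .{{_ : NonZero k}} → Fin k
zeroC k = 0 mod k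

module Submission where

-- Transporting the identity frame of M₀ along the correlations identifies every Mᵢ with
-- M₀ (i even) or its dual (i odd), and the identifications of Mⱼ and Mⱼ₊₁ agree across
-- the gluing map φ″ⱼ; so they assemble into an isomorphism of the glued structure with
-- M₀ ⊛∘ G.  Over ℤ the frame is pushed forward along φᵢ and backward along φᵢ⁻¹.  Over
-- C_k it is pushed forward from 0, and the last gluing, from k − 1 back to 0, is compatible
-- precisely because φ_{k−1} ∘ ⋯ ∘ φ₀ fixes the points of M₀.

open import Defs
open import Data.Bool using (Bool; true; false; not)
open import Data.Bool.Properties using (not-involutive; not-injective)
open import Data.Nat using (ℕ; zero; suc; NonZero; _<_; _%_; _*_; s<s)
open import Data.Nat.Properties using (m<1+n⇒m<n∨m≡n; <⇒≤)
open import Data.Nat.DivMod using (m<n⇒m%n≡m; n%n≡0)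
open import Data.Nat.Divisibility using (_∣_; divides)
open import Data.Integer using (ℤ; +_; -[1+_])
open import Data.Fin using (Fin; toℕ)
open import Data.Fin.Properties using (toℕ-fromℕ<; toℕ-injective; toℕ<n)
open import Data.Product using (_×_; _,_)
open import Data.Product.Function.Dependent.Propositional using (Σ-↔)
open import Data.Sum using (inj₁; inj₂)
open import Function.Bundles using (_↔_; _⇔_; Inverse; Equivalence; Bijection; mk⇔)
open import Function.Construct.Identity using (↔-id; ⇔-id)
open import Function.Construct.Composition using (_↔-∘_; _⇔-∘_)
open import Function.Construct.Symmetry using (↔-sym; ⇔-sym)
open import Function.Properties.Inverse using (↔⇒⤖)
open import Relation.Binary.PropositionalEquality
open import Relation.Binary.HeterogeneousEquality as H using (_≅_; ≅-to-≡; ≡-to-≅)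

open Inverse using (to; from; strictlyInverseˡ; strictlyInverseʳ)
open Correlation using (φ′; φ″)

↔-injective : ∀ {A B : Set} (f : A ↔ B) {x y} → to f x ≡ to f y → x ≡ y
↔-injective f = Bijection.injective (↔⇒⤖ f)

I-cong : ∀ (N : IncStr) {a a′ l l′} → a ≡ a′ → l ≡ l′ → _I_ N a l ⇔ _I_ N a′ l′
I-cong N refl refl = ⇔-id _

-- A frame of parity p identifies N with M0 (p = true) or with its dual (p = false),
-- i.e. with the layers of M0 ⊛∘ G of that parity.
module Frames (M0 : IncStr) (G : Set) (sc : G → G) (par : G → Bool) where
  open DualMult M0 G sc par

  record Frame (N : IncStr) (p : Bool) : Set where
    field
      pt  : Point N ↔ Pt p
      ln  : Line N ↔ Ln p
      inc : ∀ a l → _I_ N a l ⇔ IncE p (to pt a) (to ln l)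
  open Frame public

  swap : (p : Bool) → Ln p ↔ Pt (not p)
  swap true  = ↔-id _
  swap false = ↔-id _

  swap′ : (p : Bool) → Pt p ↔ Ln (not p)
  swap′ true  = ↔-id _
  swap′ false = ↔-id _

  IncE-swap : ∀ p x y → IncE p x y ⇔ IncE (not p) (to (swap p) y) (to (swap′ p) x)
  IncE-swap true  x y = ⇔-id _
  IncE-swap false x y = ⇔-id _

  SameE-swap : ∀ p y → SameE (not p) p (to (swap p) y) y
  SameE-swap true  y = refl
  SameE-swap false y = refl

  SameE-swap′ : ∀ q x → SameE q (not q) x (to (swap′ q) x)
  SameE-swap′ true  x = refl
  SameE-swap′ false x = refl

  SameE-functional : ∀ {q p x x′ y} → SameE q p x y → SameE q p x′ y → x ≡ x′
  SameE-functional {true}  {false} = λ e e′ → trans e (sym e′)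
  SameE-functional {false} {true}  = λ e e′ → trans e (sym e′)

  base : Frame M0 true
  base = record { pt = ↔-id _ ; ln = ↔-id _ ; inc = λ _ _ → ⇔-id _ }

  Compatible : ∀ {N N′ p q} → Correlation N N′ → Frame N p → Frame N′ q → Set
  Compatible {p = p} {q} φ c c′ = ∀ m → SameE q p (to (pt c′) (to (φ″ φ) m)) (to (ln c) m)

  module _ {N N′ : IncStr} (φ : Correlation N N′) where

    forward : ∀ {p} → Frame N p → Frame N′ (not p)
    forward {p} c = record
      { pt  = swap p ↔-∘ (ln c ↔-∘ ↔-sym (φ″ φ))
      ; ln  = swap′ p ↔-∘ (pt c ↔-∘ ↔-sym (φ′ φ))
      ; inc = λ a l →
          IncE-swap p _ _ ⇔-∘ (inc c _ _ ⇔-∘ (⇔-sym (Correlation.inc φ _ _) ⇔-∘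
            I-cong N′ (sym (strictlyInverseˡ (φ″ φ) a)) (sym (strictlyInverseˡ (φ′ φ) l))))
      }

    forward-compatible : ∀ {p} (c : Frame N p) → Compatible φ c (forward c)
    forward-compatible {p} c m =
      subst (SameE (not p) p (to (swap p) (to (ln c) (from (φ″ φ) (to (φ″ φ) m)))))
        (cong (to (ln c)) (strictlyInverseʳ (φ″ φ) m))
        (SameE-swap p _)

    backward : ∀ {q} → Frame N′ q → Frame N (not q)
    backward {q} c′ = record
      { pt  = swap q ↔-∘ (ln c′ ↔-∘ φ′ φ)
      ; ln  = swap′ q ↔-∘ (pt c′ ↔-∘ φ″ φ)
      ; inc = λ a l → IncE-swap q _ _ ⇔-∘ (inc c′ _ _ ⇔-∘ Correlation.inc φ a l)
      }

    backward-compatible : ∀ {q} (c′ : Frame N′ q) → Compatible φ (backward c′) c′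
    backward-compatible {q} c′ m = SameE-swap′ q _

  module _ (M : G → IncStr) (φ : (i : G) → Correlation (M i) (M (sc i)))
           (c : ∀ i → Frame (M i) (par i))
           (compatible : ∀ j → Compatible (φ j) (c j) (c (sc j))) where
    open Glue G sc M φ using (GInc; same; next)

    incidence-to : ∀ {i a j m} → GInc (i , a) (j , m) →
      DInc (i , to (pt (c i)) a) (j , to (ln (c j)) m)
    incidence-to (same h) = same (Equivalence.to (inc (c _) _ _) h)
    incidence-to (next m) = next (compatible _ m)

    incidence-from : ∀ {i a j m} → DInc (i , to (pt (c i)) a) (j , to (ln (c j)) m) →
      GInc (i , a) (j , m)
    incidence-from (same h) = same (Equivalence.from (inc (c _) _ _) h)
    incidence-from {j = j} {m = m} (next h) =
      subst (λ a → GInc (sc j , a) (j , m))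
        (↔-injective (pt (c (sc j))) (SameE-functional (compatible j m) h))
        (next m)

    glue≅dualMult : glue G sc M φ ≅ᴵ dualMult M0 G sc par
    glue≅dualMult = record
      { pt  = Σ-↔ (↔-id G) (pt (c _))
      ; ln  = Σ-↔ (↔-id G) (ln (c _))
      ; inc = λ { (i , a) (j , m) → mk⇔ incidence-to incidence-from }
      }

module GlueIteration (G : Set) (sc : G → G) (M : G → IncStr)
                     (φ : (i : G) → Correlation (M i) (M (sc i))) where
  open Glue G sc M φ using (Elt; step; iter; scⁿ; flipⁿ)

  iter-snoc : ∀ n j b x → iter (suc n) j b x ≅ step (scⁿ n j) (flipⁿ n b) (iter n j b x)
  iter-snoc zero    j b x = H.refl
  iter-snoc (suc n) j b x = iter-snoc n (sc j) (not b) (step j b x)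

  scⁿ-suc : ∀ n j → sc (scⁿ n j) ≡ scⁿ (suc n) j
  scⁿ-suc zero    j = refl
  scⁿ-suc (suc n) j = scⁿ-suc n (sc j)

  flipⁿ-suc : ∀ n b → not (flipⁿ n b) ≡ flipⁿ (suc n) b
  flipⁿ-suc zero    b = refl
  flipⁿ-suc (suc n) b = flipⁿ-suc n (not b)

  step-cong : ∀ {j j′ b b′} {x : Elt j b} {x′ : Elt j′ b′} →
    j ≡ j′ → b ≡ b′ → x ≅ x′ → step j b x ≅ step j′ b′ x′
  step-cong refl refl H.refl = H.refl

module Orbit (G : Set) (sc : G → G) (par : G → Bool) (M : G → IncStr)
             (φ : (i : G) → Correlation (M i) (M (sc i))) (z : G) where
  open Frames (M z) G sc par
  open Glue G sc M φ using (Elt; step; iter; scⁿ; flipⁿ)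
  open GlueIteration G sc M φ

  orbit : ℕ → G
  orbit zero    = z
  orbit (suc n) = sc (orbit n)

  frame : ∀ n → Frame (M (orbit n)) (evenℕ n)
  frame zero    = base
  frame (suc n) = forward (φ (orbit n)) (frame n)

  frameAt : ∀ n {i} → orbit n ≡ i → Frame (M i) (evenℕ n)
  frameAt n refl = frame n

  frameAt-compatible : ∀ {n n′ j} → n′ ≡ suc n → (e : orbit n ≡ j) (e′ : orbit n′ ≡ sc j) →
    Compatible (φ j) (frameAt n e) (frameAt n′ e′)
  frameAt-compatible {n} refl refl refl = forward-compatible (φ (orbit n)) (frame n)

  frameAt-zero : ∀ {i} (e : z ≡ i) y → to (pt (frameAt 0 e)) y ≅ y
  frameAt-zero refl y = H.refl

  fromPoint : ∀ {j} p → Frame (M j) p → Point (M z) → Elt j p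
  fromPoint true  c = from (pt c)
  fromPoint false c = from (ln c)

  step-fromPoint : ∀ {j} p (c : Frame (M j) p) x →
    step j p (fromPoint p c x) ≡ fromPoint (not p) (forward (φ j) c) x
  step-fromPoint true  c x = refl
  step-fromPoint false c x = refl

  orbit≡scⁿ : ∀ n → orbit n ≡ scⁿ n z
  orbit≡scⁿ zero    = refl
  orbit≡scⁿ (suc n) = trans (cong sc (orbit≡scⁿ n)) (scⁿ-suc n z)

  evenℕ≡flipⁿ : ∀ n → evenℕ n ≡ flipⁿ n true
  evenℕ≡flipⁿ zero    = refl
  evenℕ≡flipⁿ (suc n) = trans (cong not (evenℕ≡flipⁿ n)) (flipⁿ-suc n true)

  iter-frame : ∀ n x → iter n z true x ≅ fromPoint (evenℕ n) (frame n) x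
  iter-frame zero    x = H.refl
  iter-frame (suc n) x = begin
    iter (suc n) z true x
      ≅⟨ iter-snoc n z true x ⟩
    step (scⁿ n z) (flipⁿ n true) (iter n z true x)
      ≅⟨ step-cong (sym (orbit≡scⁿ n)) (sym (evenℕ≡flipⁿ n)) (iter-frame n x) ⟩
    step (orbit n) (evenℕ n) (fromPoint (evenℕ n) (frame n) x)
      ≡⟨ step-fromPoint (evenℕ n) (frame n) x ⟩
    fromPoint (evenℕ (suc n)) (frame (suc n)) x
      ∎
    where open H.≅-Reasoning

  compatible-frameAt-zero : ∀ {j p} (c : Frame (M j) p) (e : z ≡ sc j) → p ≡ false →
    (∀ x → step j p (fromPoint p c x) ≅ x) → Compatible (φ j) c (frameAt 0 e)
  compatible-frameAt-zero {j} c e refl closes m = ≅-to-≡ (begin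
    to (pt (frameAt 0 e)) (to (φ″ (φ j)) m)
      ≅⟨ frameAt-zero e _ ⟩
    to (φ″ (φ j)) m
      ≡⟨ cong (to (φ″ (φ j))) (strictlyInverseʳ (ln c) m) ⟨
    to (φ″ (φ j)) (from (ln c) (to (ln c) m))
      ≅⟨ closes (to (ln c) m) ⟩
    to (ln c) m
      ∎)
    where open H.≅-Reasoning

module Integers (M : ℤ → IncStr) (φ : (i : ℤ) → Correlation (M i) (M (sucℤ i))) where
  open Frames (M (+ 0)) ℤ sucℤ evenℤ

  frameℤ : ∀ i → Frame (M i) (evenℤ i)
  frameℤ (+ zero)        = base
  frameℤ (+ suc n)       = forward (φ (+ n)) (frameℤ (+ n))
  frameℤ -[1+ zero ]     = backward (φ -[1+ zero ]) (frameℤ (+ zero))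
  frameℤ -[1+ suc n ]    = backward (φ -[1+ suc n ]) (frameℤ -[1+ n ])

  frameℤ-compatible : ∀ j → Compatible (φ j) (frameℤ j) (frameℤ (sucℤ j))
  frameℤ-compatible (+ n)        = forward-compatible (φ (+ n)) (frameℤ (+ n))
  frameℤ-compatible -[1+ zero ]  = backward-compatible (φ -[1+ zero ]) (frameℤ (+ zero))
  frameℤ-compatible -[1+ suc n ] = backward-compatible (φ -[1+ suc n ]) (frameℤ -[1+ n ])

  glueℤ≅dualMult : glue ℤ sucℤ M φ ≅ᴵ dualMult (M (+ 0)) ℤ sucℤ evenℤ
  glueℤ≅dualMult = glue≅dualMult M φ frameℤ frameℤ-compatible

evenℕ-double : ∀ q → evenℕ (q * 2) ≡ true
evenℕ-double zero    = refl
evenℕ-double (suc q) = trans (not-involutive _) (evenℕ-double q)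

module Cyclic (k′ : ℕ) (k′-odd : evenℕ k′ ≡ false) (M : Fin (suc k′) → IncStr)
              (φ : (i : Fin (suc k′)) → Correlation (M i) (M (sucC (suc k′) i)))
              (returns : ∀ a → Glue.iter (Fin (suc k′)) (sucC (suc k′)) M φ
                                 (suc k′) (zeroC (suc k′)) true a ≅ a) where
  private
    k = suc k′
  open Frames (M (zeroC k)) (Fin k) (sucC k) (evenC k)
  open Orbit (Fin k) (sucC k) (evenC k) M φ (zeroC k)
  open Glue (Fin k) (sucC k) M φ using (step)

  toℕ-sucC : ∀ i → toℕ (sucC k i) ≡ suc (toℕ i) % k
  toℕ-sucC i = toℕ-fromℕ< _

  toℕ-orbit : ∀ n → n < k → toℕ (orbit n) ≡ n
  toℕ-orbit zero    _   = refl
  toℕ-orbit (suc n) n<k = begin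
    toℕ (sucC k (orbit n))  ≡⟨ toℕ-sucC (orbit n) ⟩
    suc (toℕ (orbit n)) % k ≡⟨ cong (λ t → suc t % k) (toℕ-orbit n (<⇒≤ n<k)) ⟩
    suc n % k               ≡⟨ m<n⇒m%n≡m n<k ⟩
    suc n                   ∎
    where open ≡-Reasoning

  orbit-toℕ : ∀ i → orbit (toℕ i) ≡ i
  orbit-toℕ i = toℕ-injective (toℕ-orbit (toℕ i) (toℕ<n i))

  frameC : ∀ i → Frame (M i) (evenC k i)
  frameC i = frameAt (toℕ i) (orbit-toℕ i)

  once-around : ∀ x → step (orbit k′) (evenℕ k′) (fromPoint (evenℕ k′) (frame k′) x) ≅ x
  once-around x = H.trans (≡-to-≅ (step-fromPoint (evenℕ k′) (frame k′) x))
                          (H.trans (H.sym (iter-frame k x)) (returns x))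

  frameAt-compatible-wrap : ∀ {n n′ j} → n ≡ k′ → n′ ≡ 0 → (e : orbit n ≡ j) (e′ : orbit n′ ≡ sucC k j) →
    Compatible (φ j) (frameAt n e) (frameAt n′ e′)
  frameAt-compatible-wrap refl refl refl e′ = compatible-frameAt-zero (frame k′) e′ k′-odd once-around

  frameC-compatible : ∀ j → Compatible (φ j) (frameC j) (frameC (sucC k j))
  frameC-compatible j with m<1+n⇒m<n∨m≡n (toℕ<n j)
  ... | inj₁ j<k′ = frameAt-compatible
                      (trans (toℕ-sucC j) (m<n⇒m%n≡m (s<s j<k′))) (orbit-toℕ j) (orbit-toℕ (sucC k j))
  ... | inj₂ j≡k′ = frameAt-compatible-wrap j≡k′
                      (trans (toℕ-sucC j) (trans (cong (λ t → suc t % k) j≡k′) (n%n≡0 k)))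
                      (orbit-toℕ j) (orbit-toℕ (sucC k j))

  glueC≅dualMult : glue (Fin k) (sucC k) M φ ≅ᴵ dualMult (M (zeroC k)) (Fin k) (sucC k) (evenC k)
  glueC≅dualMult = glue≅dualMult M φ frameC frameC-compatible

proposition4p4 :
    (∀ (M : ℤ → ConnPLS)
       (φ : (i : ℤ) → Correlation (ConnPLS.str (M i)) (ConnPLS.str (M (sucℤ i)))) →
       glue ℤ sucℤ (λ i → ConnPLS.str (M i)) φ
         ≅ᴵ dualMult (ConnPLS.str (M (+ 0))) ℤ sucℤ evenℤ)
    ×
    (∀ (k : ℕ) .{{_ : NonZero k}} → 2 ∣ k → 2 < k →
       (M : Fin k → ConnPLS)
       (φ : (i : Fin k) → Correlation (ConnPLS.str (M i)) (ConnPLS.str (M (sucC k i)))) →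
       (∀ (a : Point (ConnPLS.str (M (zeroC k)))) →
          Glue.iter (Fin k) (sucC k) (λ i → ConnPLS.str (M i)) φ k (zeroC k) true a ≅ a) →
       (∀ (l : Line (ConnPLS.str (M (zeroC k)))) →
          Glue.iter (Fin k) (sucC k) (λ i → ConnPLS.str (M i)) φ k (zeroC k) false l ≅ l) →
       glue (Fin k) (sucC k) (λ i → ConnPLS.str (M i)) φ
         ≅ᴵ dualMult (ConnPLS.str (M (zeroC k))) (Fin k) (sucC k) (evenC k))
proposition4p4 =
    (λ M φ → Integers.glueℤ≅dualMult (λ i → ConnPLS.str (M i)) φ)
  , λ { zero _ () ; (suc k′) (divides q k≡q*2) _ M φ returns _ →
        Cyclic.glueC≅dualMult k′ (not-injective (trans (cong evenℕ k≡q*2) (evenℕ-double q)))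
          (λ i → ConnPLS.str (M i)) φ returns }
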